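{- Let $k\geq 1$, $n=8k+7$, and $G=C(n,\pm\{1,2,3,4\})$. Then $\dim(G)\leq 6$.
   Context: $C(n,\pm\{1,2,3,4\})$ is the graph on $\mathbb{Z}_n$ where distinct $i,j$ are adjacent iff $j-i\equiv\pm s\pmod n$ for some $s\in\{1,2,3,4\}$. The metric dimension $\dim(G)$ is the minimum size of a set $X$ of vertices such that for any two distinct vertices $u,v$ some $x\in X$ has $d(x,u)\neq d(x,v)$. -}

module Defs where

open import Data.Nat using (ℕ; zero; suc; _+_; _*_; _≤_; _<_)
open import Data.Fin using (Fin; toℕ)
open import Data.List using (List; length)
open import Data.List.Membership.Propositional using (_∈_)
open import Data.Product using (Σ; ∃; _×_; ∃-syntax)
open import Data.Sum using (_⊎_)
open import Relation.Binary.PropositionalEquality using (_≡_; _≢_)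
open import Relation.Nullary using (¬_)

data Walk {V : Set} (Adj : V → V → Set) : V → V → ℕ → Set where
  here : ∀ {u} → Walk Adj u u 0
  step : ∀ {u w v m} → Adj u w → Walk Adj w v m → Walk Adj u v (suc m)

IsDist : {V : Set} → (V → V → Set) → V → V → ℕ → Set
IsDist Adj u v m = Walk Adj u v m × (∀ m′ → m′ < m → ¬ Walk Adj u v m′)

Resolving : {V : Set} → (V → V → Set) → List V → Set
Resolving {V} Adj X =
  (u v : V) → u ≢ v →
  ∃[ x ] (x ∈ X × ∃[ a ] ∃[ b ] (IsDist Adj x u a × IsDist Adj x v b × a ≢ b))

MetricDimLE : {V : Set} → (V → V → Set) → ℕ → Set
MetricDimLE {V} Adj c = ∃[ X ] (length X ≤ c × Resolving Adj X)

-- The circulant graph C(n, ±{1,2,3,4}) on ℤ_n = Fin n: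
-- distinct i, j adjacent iff j - i ≡ ±s (mod n) for some s ∈ {1,2,3,4}.
data Gen : ℕ → Set where
  g1 : Gen 1
  g2 : Gen 2
  g3 : Gen 3
  g4 : Gen 4

AddCong : (n : ℕ) → Fin n → ℕ → Fin n → Set
AddCong n a s b = ∃[ q ] (toℕ a + s ≡ toℕ b + q * n)

Circ1234 : (n : ℕ) → Fin n → Fin n → Set
Circ1234 n i j =
  i ≢ j × ∃[ s ] (Gen s × (AddCong n i s j ⊎ AddCong n j s i))

-- In C(n, ±{1,2,3,4}) the distance from a to b is ⌈min(c, n − c)/4⌉, where c is the
-- offset of b from a: steps of length 4 in the shorter direction attain it, and it changes
-- by at most 1 along an edge. Take the landmarks 0, …, 5. A vertex u ≤ 5 is a landmark
-- itself; for u ≥ 6 its distances to the landmarks are f(u), f(u − 1), …, f(u − 5) with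
-- f(c) = ⌈min(c, n − c)/4⌉. For n = 8k + 7 such a window equals a level plus one of eleven
-- shapes: four on the rising part of f (one per residue of u mod 4), three at its peak and
-- four on the falling part. No two shapes are translates of each other (a finite check),
-- so the window determines the shape and the level, and these determine u.
module Submission where

open import Defs
open import Data.Nat using (ℕ; zero; suc; _+_; _*_; _∸_; _⊓_; _≤_; _<_; z≤n; s≤s; s≤s⁻¹; NonZero; >-nonZero; _%_; _/_)
open import Data.Nat.Properties
open import Data.Nat.DivMod
open import Data.Nat.Divisibility using (divides)
open import Data.Nat.Tactic.RingSolver using (solve-∀)
open import Data.Fin.Base as Fin using (Fin; toℕ; fromℕ<; inject≤)
import Data.Fin.Properties as Fin
open import Data.Product using (∃-syntax; _×_; _,_; proj₁; proj₂)
open import Data.Sum using (inj₁; inj₂)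
open import Data.Empty using (⊥-elim)
open import Data.List.Base using (List; tabulate)
open import Data.List.Membership.Propositional using (_∈_)
open import Data.List.Membership.Propositional.Properties using (∈-tabulate⁺)
open import Relation.Nullary using (yes; no)
open import Relation.Nullary.Decidable using (Dec; map′; _×-dec_; _→-dec_; toWitness; decidable-stable; ¬?)
open import Relation.Binary.Definitions using (Symmetric; DecidableEquality)
open import Relation.Binary.PropositionalEquality

⌈_/4⌉ : ℕ → ℕ
⌈ m /4⌉ = (m + 3) / 4

⌈4a+m/4⌉≡a+⌈m/4⌉ : ∀ a m → ⌈ 4 * a + m /4⌉ ≡ a + ⌈ m /4⌉
⌈4a+m/4⌉≡a+⌈m/4⌉ a m = begin
  (4 * a + m + 3) / 4       ≡⟨ /-congˡ (+-assoc (4 * a) m 3) ⟩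
  (4 * a + (m + 3)) / 4     ≡⟨ +-distrib-/-∣ˡ (m + 3) (divides a (*-comm 4 a)) ⟩
  4 * a / 4 + (m + 3) / 4   ≡⟨ cong (_+ ⌈ m /4⌉) (trans (/-congˡ (*-comm 4 a)) (m*n/n≡m a 4)) ⟩
  a + ⌈ m /4⌉               ∎
  where open ≡-Reasoning

⌈/4⌉-mono-≤ : ∀ {m n} → m ≤ n → ⌈ m /4⌉ ≤ ⌈ n /4⌉
⌈/4⌉-mono-≤ m≤n = /-monoˡ-≤ 4 (+-monoˡ-≤ 3 m≤n)

⌈/4⌉-≤-suc : ∀ {m n} → m ≤ n + 4 → ⌈ m /4⌉ ≤ suc ⌈ n /4⌉
⌈/4⌉-≤-suc {m} {n} m≤n+4 = begin
  ⌈ m /4⌉         ≤⟨ ⌈/4⌉-mono-≤ (≤-trans m≤n+4 (≤-reflexive (+-comm n 4))) ⟩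
  ⌈ 4 * 1 + n /4⌉ ≡⟨ ⌈4a+m/4⌉≡a+⌈m/4⌉ 1 n ⟩
  suc ⌈ n /4⌉     ∎
  where open ≤-Reasoning

0<s<n⇒s≢q*n : ∀ {s n} q → 0 < s → s < n → s ≢ q * n
0<s<n⇒s≢q*n zero    0<s _   refl = <-irrefl refl 0<s
0<s<n⇒s≢q*n (suc q) _   s<n refl = <⇒≱ s<n (m≤m+n _ (q * _))

x+a≡y+b∧x+c≡y+d⇒a+d≡b+c : ∀ {x y a b c d} → x + a ≡ y + b → x + c ≡ y + d → a + d ≡ b + c
x+a≡y+b∧x+c≡y+d⇒a+d≡b+c {x} {y} {a} {b} {c} {d} e₁ e₂ = +-cancelʳ-≡ (x + y) (a + d) (b + c) (begin
  a + d + (x + y)   ≡⟨ regroup x a y d ⟩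
  (x + a) + (y + d) ≡⟨ cong₂ _+_ e₁ (sym e₂) ⟩
  (y + b) + (x + c) ≡⟨ regroup y b x c ⟨
  b + c + (y + x)   ≡⟨ cong (b + c +_) (+-comm y x) ⟩
  b + c + (x + y)   ∎)
  where
  open ≡-Reasoning
  regroup : ∀ x a y d → a + d + (x + y) ≡ (x + a) + (y + d)
  regroup = solve-∀

Potential : {V : Set} → (V → V → Set) → (V → ℕ) → Set
Potential Adj f = ∀ {u w} → Adj u w → f w ≤ suc (f u)

Distinguishes : {V : Set} → (V → V → Set) → V → V → V → Set
Distinguishes Adj x u v = ∃[ a ] ∃[ b ] (IsDist Adj x u a × IsDist Adj x v b × a ≢ b)

module _ {V : Set} {Adj : V → V → Set} where

  Walk-snoc : ∀ {u v w m} → Walk Adj u v m → Adj v w → Walk Adj u w (suc m)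
  Walk-snoc here       e = step e here
  Walk-snoc (step x w) e = step x (Walk-snoc w e)

  Walk-reverse : Symmetric Adj → ∀ {u v m} → Walk Adj u v m → Walk Adj v u m
  Walk-reverse Adj-sym here       = here
  Walk-reverse Adj-sym (step x w) = Walk-snoc (Walk-reverse Adj-sym w) (Adj-sym x)

  Walk-0⇒≡ : ∀ {u v} → Walk Adj u v 0 → u ≡ v
  Walk-0⇒≡ here = refl

  potential-≤-length : ∀ {f} → Potential Adj f → ∀ {u v m} → Walk Adj u v m → f v ≤ f u + m
  potential-≤-length {f} pot {u} here = ≤-reflexive (sym (+-identityʳ (f u)))
  potential-≤-length {f} pot {u} (step {w = w} {m = m} x walk) = begin
    _              ≤⟨ potential-≤-length pot walk ⟩
    f w + m        ≤⟨ +-monoˡ-≤ m (pot x) ⟩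
    suc (f u) + m  ≡⟨ +-suc (f u) m ⟨
    f u + suc m    ∎
    where open ≤-Reasoning

  isDist-potential : ∀ {f x v} → Potential Adj f → f x ≡ 0 → Walk Adj x v (f v) → IsDist Adj x v (f v)
  isDist-potential {f} {x} {v} pot fx≡0 walk = walk , λ m m<fv walk′ →
    <⇒≱ m<fv (subst (λ z → f v ≤ z + m) fx≡0 (potential-≤-length pot walk′))

  distinguishes-self : ∀ {u v b} → u ≢ v → IsDist Adj u v b → Distinguishes Adj u u v
  distinguishes-self u≢v dist = 0 , _ , (here , λ _ ()) , dist ,
    λ 0≡b → u≢v (Walk-0⇒≡ (subst (Walk Adj _ _) (sym 0≡b) (proj₁ dist)))

  distinguishes-sym : ∀ {x u v} → Distinguishes Adj x u v → Distinguishes Adj x v u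
  distinguishes-sym (a , b , du , dv , a≢b) = b , a , dv , du , ≢-sym a≢b

Gen⇒0< : ∀ {s} → Gen s → 0 < s
Gen⇒0< g1 = s≤s z≤n
Gen⇒0< g2 = s≤s z≤n
Gen⇒0< g3 = s≤s z≤n
Gen⇒0< g4 = s≤s z≤n

Gen⇒≤4 : ∀ {s} → Gen s → s ≤ 4
Gen⇒≤4 g1 = s≤s z≤n
Gen⇒≤4 g2 = s≤s (s≤s z≤n)
Gen⇒≤4 g3 = s≤s (s≤s (s≤s z≤n))
Gen⇒≤4 g4 = ≤-refl

module Circulant (n : ℕ) {{_ : NonZero n}} (4<n : 4 < n) where

  [m%n+o]%n≡[m+o]%n : ∀ m o → (m % n + o) % n ≡ (m + o) % n
  [m%n+o]%n≡[m+o]%n m o = begin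
    (m % n + o) % n         ≡⟨ %-distribˡ-+ (m % n) o n ⟩
    (m % n % n + o % n) % n ≡⟨ cong (λ x → (x + o % n) % n) (m%n%n≡m%n m n) ⟩
    (m % n + o % n) % n     ≡⟨ %-distribˡ-+ m o n ⟨
    (m + o) % n             ∎
    where open ≡-Reasoning

  [m+o%n]%n≡[m+o]%n : ∀ m o → (m + o % n) % n ≡ (m + o) % n
  [m+o%n]%n≡[m+o]%n m o = begin
    (m + o % n) % n ≡⟨ cong (_% n) (+-comm m (o % n)) ⟩
    (o % n + m) % n ≡⟨ [m%n+o]%n≡[m+o]%n o m ⟩
    (o + m) % n     ≡⟨ cong (_% n) (+-comm o m) ⟩
    (m + o) % n     ∎
    where open ≡-Reasoning

  [m+n]%n≡m : ∀ {m} → m < n → (m + n) % n ≡ m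
  [m+n]%n≡m {m} m<n = trans ([m+n]%n≡m%n m n) (m<n⇒m%n≡m m<n)

  [m+s]%n≢m : ∀ {m s} → 0 < s → s < n → (m + s) % n ≢ m
  [m+s]%n≢m {m} {s} 0<s s<n eq = 0<s<n⇒s≢q*n ((m + s) / n) 0<s s<n
    (+-cancelˡ-≡ m s _ (trans (m≡m%n+[m/n]*n (m + s) n) (cong (_+ (m + s) / n * n) eq)))

  Gen⇒<n : ∀ {s} → Gen s → s < n
  Gen⇒<n g = ≤-<-trans (Gen⇒≤4 g) 4<n

  adjacent : ∀ {s a b} → Gen s → (toℕ a + s) % n ≡ toℕ b → Circ1234 n a b
  adjacent {s} {a} g eq =
    (λ a≡b → [m+s]%n≢m (Gen⇒0< g) (Gen⇒<n g) (trans eq (cong toℕ (sym a≡b)))) ,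
    s , g , inj₁ ((toℕ a + s) / n ,
      trans (m≡m%n+[m/n]*n (toℕ a + s) n) (cong (_+ (toℕ a + s) / n * n) eq))

  Circ-sym : Symmetric (Circ1234 n)
  Circ-sym (i≢j , s , g , inj₁ i+s≡j) = ≢-sym i≢j , s , g , inj₂ i+s≡j
  Circ-sym (i≢j , s , g , inj₂ j+s≡i) = ≢-sym i≢j , s , g , inj₁ j+s≡i

  walk-forward : ∀ c a b → (toℕ a + c) % n ≡ toℕ b → Walk (Circ1234 n) a b ⌈ c /4⌉
  walk-forward zero a b eq = subst (λ b → Walk (Circ1234 n) a b 0) (Fin.toℕ-injective a≡b) here
    where
    a≡b : toℕ a ≡ toℕ b
    a≡b = trans (sym (m<n⇒m%n≡m (Fin.toℕ<n a))) (trans (cong (_% n) (sym (+-identityʳ _))) eq)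
  walk-forward 1 a b eq = step (adjacent g1 eq) here
  walk-forward 2 a b eq = step (adjacent g2 eq) here
  walk-forward 3 a b eq = step (adjacent g3 eq) here
  walk-forward (suc (suc (suc (suc c)))) a b eq =
    subst (Walk (Circ1234 n) a b) (sym (⌈4a+m/4⌉≡a+⌈m/4⌉ 1 c))
      (step (adjacent g4 (sym (Fin.toℕ-fromℕ< _))) (walk-forward c a+4 b a+4+c≡b))
    where
    a+4 : Fin n
    a+4 = fromℕ< (m%n<n (toℕ a + 4) n)
    a+4+c≡b : (toℕ a+4 + c) % n ≡ toℕ b
    a+4+c≡b = begin
      (toℕ a+4 + c) % n           ≡⟨ cong (λ x → (x + c) % n) (Fin.toℕ-fromℕ< _) ⟩
      ((toℕ a + 4) % n + c) % n   ≡⟨ [m%n+o]%n≡[m+o]%n (toℕ a + 4) c ⟩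
      (toℕ a + 4 + c) % n         ≡⟨ cong (_% n) (+-assoc (toℕ a) 4 c) ⟩
      (toℕ a + (4 + c)) % n       ≡⟨ eq ⟩
      toℕ b                       ∎
      where open ≡-Reasoning

  infix 7 _⊖_

  _⊖_ : Fin n → Fin n → ℕ
  b ⊖ a = (toℕ b + (n ∸ toℕ a)) % n

  ⊖<n : ∀ b a → b ⊖ a < n
  ⊖<n b a = m%n<n _ n

  a+[n∸a]≡n : ∀ (a : Fin n) → toℕ a + (n ∸ toℕ a) ≡ n
  a+[n∸a]≡n a = m+[n∸m]≡n (<⇒≤ (Fin.toℕ<n a))

  ⊖-self : ∀ a → a ⊖ a ≡ 0
  ⊖-self a = trans (cong (_% n) (a+[n∸a]≡n a)) (n%n≡0 n)

  ⊖-of-≤ : ∀ {a b} → toℕ a ≤ toℕ b → b ⊖ a ≡ toℕ b ∸ toℕ a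
  ⊖-of-≤ {a} {b} a≤b = begin
    (toℕ b + (n ∸ toℕ a)) % n         ≡⟨ cong (λ x → (x + (n ∸ toℕ a)) % n) (m∸n+n≡m a≤b) ⟨
    (d + toℕ a + (n ∸ toℕ a)) % n     ≡⟨ cong (_% n) (+-assoc d (toℕ a) _) ⟩
    (d + (toℕ a + (n ∸ toℕ a))) % n   ≡⟨ cong (λ x → (d + x) % n) (a+[n∸a]≡n a) ⟩
    (d + n) % n                       ≡⟨ [m+n]%n≡m (≤-<-trans (m∸n≤m (toℕ b) (toℕ a)) (Fin.toℕ<n b)) ⟩
    d                                 ∎
    where
    open ≡-Reasoning
    d = toℕ b ∸ toℕ a

  [a+[b⊖a]]%n≡b : ∀ a b → (toℕ a + b ⊖ a) % n ≡ toℕ b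
  [a+[b⊖a]]%n≡b a b = begin
    (toℕ a + b ⊖ a) % n                     ≡⟨ [m+o%n]%n≡[m+o]%n (toℕ a) _ ⟩
    (toℕ a + (toℕ b + (n ∸ toℕ a))) % n     ≡⟨ cong (_% n) (swap (toℕ a) (toℕ b) _) ⟩
    (toℕ b + (toℕ a + (n ∸ toℕ a))) % n     ≡⟨ cong (λ x → (toℕ b + x) % n) (a+[n∸a]≡n a) ⟩
    (toℕ b + n) % n                         ≡⟨ [m+n]%n≡m (Fin.toℕ<n b) ⟩
    toℕ b                                   ∎
    where
    open ≡-Reasoning
    swap : ∀ x y z → x + (y + z) ≡ y + (x + z)
    swap = solve-∀

  [b+[n∸b⊖a]]%n≡a : ∀ a b → (toℕ b + (n ∸ b ⊖ a)) % n ≡ toℕ a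
  [b+[n∸b⊖a]]%n≡a a b = begin
    (toℕ b + (n ∸ c)) % n               ≡⟨ cong (λ x → (x + (n ∸ c)) % n) ([a+[b⊖a]]%n≡b a b) ⟨
    ((toℕ a + c) % n + (n ∸ c)) % n     ≡⟨ [m%n+o]%n≡[m+o]%n (toℕ a + c) (n ∸ c) ⟩
    (toℕ a + c + (n ∸ c)) % n           ≡⟨ cong (_% n) (+-assoc (toℕ a) c (n ∸ c)) ⟩
    (toℕ a + (c + (n ∸ c))) % n         ≡⟨ cong (λ x → (toℕ a + x) % n) (m+[n∸m]≡n (<⇒≤ (⊖<n b a))) ⟩
    (toℕ a + n) % n                     ≡⟨ [m+n]%n≡m (Fin.toℕ<n a) ⟩
    toℕ a                               ∎
    where
    open ≡-Reasoning
    c = b ⊖ a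

  ⊖-shift : ∀ a {i j s} → AddCong n i s j → j ⊖ a ≡ (i ⊖ a + s) % n
  ⊖-shift a {i} {j} {s} (q , i+s≡j+qn) = sym (begin
    ((toℕ i + N) % n + s) % n ≡⟨ [m%n+o]%n≡[m+o]%n (toℕ i + N) s ⟩
    (toℕ i + N + s) % n       ≡⟨ cong (_% n) (swap (toℕ i) N s) ⟩
    (toℕ i + s + N) % n       ≡⟨ cong (λ x → (x + N) % n) i+s≡j+qn ⟩
    (toℕ j + q * n + N) % n   ≡⟨ cong (_% n) (swap (toℕ j) (q * n) N) ⟩
    (toℕ j + N + q * n) % n   ≡⟨ [m+kn]%n≡m%n (toℕ j + N) q n ⟩
    (toℕ j + N) % n           ∎)
    where
    open ≡-Reasoning
    N = n ∸ toℕ a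
    swap : ∀ x y z → x + y + z ≡ x + z + y
    swap = solve-∀

  cyclicNorm : ℕ → ℕ
  cyclicNorm c = c ⊓ (n ∸ c)

  cyclicNorm-+ : ∀ {c s} → c < n → s ≤ n →
                 cyclicNorm ((c + s) % n) ≤ cyclicNorm c + s × cyclicNorm c ≤ cyclicNorm ((c + s) % n) + s
  cyclicNorm-+ {c} {s} c<n s≤n with c + s <? n
  ... | yes c+s<n rewrite m<n⇒m%n≡m c+s<n = shorter , longer
    where
    shorter : (c + s) ⊓ (n ∸ (c + s)) ≤ c ⊓ (n ∸ c) + s
    shorter = subst ((c + s) ⊓ (n ∸ (c + s)) ≤_) (sym (+-distribʳ-⊓ s c (n ∸ c)))
      (⊓-mono-≤ ≤-refl (≤-trans (∸-monoʳ-≤ n (m≤m+n c s)) (m≤m+n (n ∸ c) s)))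
    n∸c≤n∸[c+s]+s : n ∸ c ≤ n ∸ (c + s) + s
    n∸c≤n∸[c+s]+s = subst (n ∸ c ≤_) (trans (cong (s +_) (∸-+-assoc n c s)) (+-comm s _))
      (m≤n+m∸n (n ∸ c) s)
    longer : c ⊓ (n ∸ c) ≤ (c + s) ⊓ (n ∸ (c + s)) + s
    longer = subst (c ⊓ (n ∸ c) ≤_) (sym (+-distribʳ-⊓ s (c + s) (n ∸ (c + s))))
      (⊓-mono-≤ (≤-trans (m≤m+n c s) (m≤m+n (c + s) s)) n∸c≤n∸[c+s]+s)
  ... | no c+s≮n with m≤n⇒∃[o]m+o≡n (≮⇒≥ c+s≮n)
  ...   | e , n+e≡c+s =
    subst (λ x → cyclicNorm x ≤ cyclicNorm c + s × cyclicNorm c ≤ cyclicNorm x + s) (sym [c+s]%n≡e)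
      (shorter , longer)
    where
    e<s : e < s
    e<s = +-cancelˡ-< n e s (subst (_< n + s) (sym n+e≡c+s) (+-monoˡ-< s c<n))
    [c+s]%n≡e : (c + s) % n ≡ e
    [c+s]%n≡e = trans (cong (_% n) (trans (sym n+e≡c+s) (+-comm n e))) ([m+n]%n≡m (<-≤-trans e<s s≤n))
    shorter : cyclicNorm e ≤ cyclicNorm c + s
    shorter = ≤-trans (m⊓n≤m e (n ∸ e)) (≤-trans (<⇒≤ e<s) (m≤n+m s _))
    longer : cyclicNorm c ≤ cyclicNorm e + s
    longer = ≤-trans (m⊓n≤n c (n ∸ c))
      (≤-trans (m≤n+o⇒m∸n≤o n c (≤-trans (m≤m+n n e) (≤-reflexive n+e≡c+s))) (m≤n+m s _))

  cyclicNorm-of-≤ : ∀ {c} → c + c ≤ n → cyclicNorm c ≡ c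
  cyclicNorm-of-≤ {c} c+c≤n = m≤n⇒m⊓n≡m (m+n≤o⇒m≤o∸n c c+c≤n)

  cyclicNorm-reflect : ∀ {m} → m ≤ n → cyclicNorm (n ∸ m) ≡ cyclicNorm m
  cyclicNorm-reflect {m} m≤n = trans (cong ((n ∸ m) ⊓_) (m∸[m∸n]≡n m≤n)) (⊓-comm (n ∸ m) m)

  offsetDist : ℕ → ℕ
  offsetDist c = ⌈ cyclicNorm c /4⌉

  offsetDist-potential : ∀ a → Potential (Circ1234 n) (λ v → offsetDist (v ⊖ a))
  offsetDist-potential a {u} {w} (_ , s , g , inj₁ u+s≡w) rewrite ⊖-shift a u+s≡w =
    ⌈/4⌉-≤-suc (≤-trans (proj₁ (cyclicNorm-+ (⊖<n u a) s≤n)) (+-monoʳ-≤ _ (Gen⇒≤4 g)))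
    where s≤n = <⇒≤ (Gen⇒<n g)
  offsetDist-potential a {u} {w} (_ , s , g , inj₂ w+s≡u) rewrite ⊖-shift a w+s≡u =
    ⌈/4⌉-≤-suc (≤-trans (proj₂ (cyclicNorm-+ (⊖<n w a) s≤n)) (+-monoʳ-≤ _ (Gen⇒≤4 g)))
    where s≤n = <⇒≤ (Gen⇒<n g)

  walk-shortest : ∀ a b → Walk (Circ1234 n) a b (offsetDist (b ⊖ a))
  walk-shortest a b with b ⊖ a ≤? n ∸ b ⊖ a
  ... | yes c≤n∸c = subst (Walk (Circ1234 n) a b) (cong ⌈_/4⌉ (sym (m≤n⇒m⊓n≡m c≤n∸c)))
    (walk-forward (b ⊖ a) a b ([a+[b⊖a]]%n≡b a b))
  ... | no c≰n∸c = subst (Walk (Circ1234 n) a b) (cong ⌈_/4⌉ (sym (m≥n⇒m⊓n≡n (<⇒≤ (≰⇒> c≰n∸c)))))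
    (Walk-reverse Circ-sym (walk-forward (n ∸ b ⊖ a) b a ([b+[n∸b⊖a]]%n≡a a b)))

  isDist-offsetDist : ∀ a b → IsDist (Circ1234 n) a b (offsetDist (b ⊖ a))
  isDist-offsetDist a b =
    isDist-potential (offsetDist-potential a) (cong offsetDist (⊖-self a)) (walk-shortest a b)

data Kind : Set where
  rising falling : Fin 4 → Kind
  peak : Fin 3 → Kind

_≟ᴷ_ : DecidableEquality Kind
rising r  ≟ᴷ rising r′  = map′ (cong rising) (λ { refl → refl }) (r Fin.≟ r′)
falling r ≟ᴷ falling r′ = map′ (cong falling) (λ { refl → refl }) (r Fin.≟ r′)
peak p    ≟ᴷ peak p′    = map′ (cong peak) (λ { refl → refl }) (p Fin.≟ p′)
rising _  ≟ᴷ falling _  = no λ ()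
rising _  ≟ᴷ peak _     = no λ ()
falling _ ≟ᴷ rising _   = no λ ()
falling _ ≟ᴷ peak _     = no λ ()
peak _    ≟ᴷ rising _   = no λ ()
peak _    ≟ᴷ falling _  = no λ ()

∀-Kind? : {P : Kind → Set} → (∀ κ → Dec (P κ)) → Dec (∀ κ → P κ)
∀-Kind? P? = map′
  (λ { (ps , qs , rs) (rising r) → ps r ; (ps , qs , rs) (falling r) → qs r ; (ps , qs , rs) (peak p) → rs p })
  (λ ∀P → (λ r → ∀P (rising r)) , (λ r → ∀P (falling r)) , (λ p → ∀P (peak p)))
  (Fin.all? (λ r → P? (rising r)) ×-dec Fin.all? (λ r → P? (falling r)) ×-dec Fin.all? (λ p → P? (peak p)))

shape : Kind → Fin 6 → ℕ
shape (rising r)  j = ⌈ toℕ r + (6 ∸ toℕ j) /4⌉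
shape (falling r) j = ⌈ suc (toℕ r) + toℕ j /4⌉
shape (peak p)    j = ⌈ m ⊓ (7 ∸ m) /4⌉  where m = 5 + toℕ p ∸ toℕ j

-- shape κ′ is a translate of shape κ, stated without subtraction
SameShape : Kind → Kind → Set
SameShape κ κ′ = ∀ j → shape κ j + shape κ′ Fin.zero ≡ shape κ′ j + shape κ Fin.zero

sameShape⇒≡ : ∀ κ κ′ → SameShape κ κ′ → κ ≡ κ′
sameShape⇒≡ = toWitness {a? = ∀-Kind? λ κ → ∀-Kind? λ κ′ → sameShape? κ κ′ →-dec κ ≟ᴷ κ′} _
  where
  sameShape? : ∀ κ κ′ → Dec (SameShape κ κ′)
  sameShape? κ κ′ = Fin.all? λ j → shape κ j + shape κ′ Fin.zero ≟ shape κ′ j + shape κ Fin.zero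

module Order8k+7 (k : ℕ) where

  n : ℕ
  n = 8 * k + 7

  n≡[4k+4]+[4k+3] : n ≡ (4 * k + 4) + (4 * k + 3)
  n≡[4k+4]+[4k+3] = split k
    where
    split : ∀ k → 8 * k + 7 ≡ (4 * k + 4) + (4 * k + 3)
    split = solve-∀

  7≤n : 7 ≤ n
  7≤n = m≤n+m 7 (8 * k)

  instance
    n-nonZero : NonZero n
    n-nonZero = >-nonZero (≤-trans (s≤s z≤n) 7≤n)

  open Circulant n (≤-trans (s≤s (s≤s (s≤s (s≤s (s≤s z≤n))))) 7≤n)

  offsetDist-middle : ∀ {m} → m ≤ 7 → offsetDist (4 * k + m) ≡ k + ⌈ m ⊓ (7 ∸ m) /4⌉
  offsetDist-middle {m} m≤7 = begin
    ⌈ (4 * k + m) ⊓ (n ∸ (4 * k + m)) /4⌉       ≡⟨ cong (λ x → ⌈ (4 * k + m) ⊓ x /4⌉) n∸[4k+m]≡4k+[7∸m] ⟩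
    ⌈ (4 * k + m) ⊓ (4 * k + (7 ∸ m)) /4⌉       ≡⟨ cong ⌈_/4⌉ (+-distribˡ-⊓ (4 * k) m (7 ∸ m)) ⟨
    ⌈ 4 * k + m ⊓ (7 ∸ m) /4⌉                   ≡⟨ ⌈4a+m/4⌉≡a+⌈m/4⌉ k _ ⟩
    k + ⌈ m ⊓ (7 ∸ m) /4⌉                       ∎
    where
    open ≡-Reasoning
    split : ∀ k m d → 8 * k + (m + d) ≡ (4 * k + m) + (4 * k + d)
    split = solve-∀
    n∸[4k+m]≡4k+[7∸m] : n ∸ (4 * k + m) ≡ 4 * k + (7 ∸ m)
    n∸[4k+m]≡4k+[7∸m] = begin
      8 * k + 7 ∸ (4 * k + m)                        ≡⟨ cong (λ x → 8 * k + x ∸ (4 * k + m)) (m+[n∸m]≡n m≤7) ⟨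
      8 * k + (m + (7 ∸ m)) ∸ (4 * k + m)            ≡⟨ cong (_∸ (4 * k + m)) (split k m (7 ∸ m)) ⟩
      (4 * k + m) + (4 * k + (7 ∸ m)) ∸ (4 * k + m)  ≡⟨ m+n∸m≡n (4 * k + m) _ ⟩
      4 * k + (7 ∸ m)                                ∎

  4k+4≤n : 4 * k + 4 ≤ n
  4k+4≤n = ≤-trans (m≤m+n (4 * k + 4) (4 * k + 3)) (≤-reflexive (sym n≡[4k+4]+[4k+3]))

  offsetDist-rising : ∀ {c} → c ≤ 4 * k + 4 → offsetDist c ≡ ⌈ c /4⌉
  offsetDist-rising {c} c≤4k+4 with m≤n⇒m<n∨m≡n c≤4k+4
  ... | inj₁ c<4k+4 = cong ⌈_/4⌉ (cyclicNorm-of-≤ {c} (begin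
    c + c                         ≤⟨ +-mono-≤ c≤4k+3 c≤4k+3 ⟩
    (4 * k + 3) + (4 * k + 3)     ≤⟨ +-monoˡ-≤ (4 * k + 3) (n≤1+n (4 * k + 3)) ⟩
    suc (4 * k + 3) + (4 * k + 3) ≡⟨ cong (_+ (4 * k + 3)) (+-suc (4 * k) 3) ⟨
    (4 * k + 4) + (4 * k + 3)     ≡⟨ n≡[4k+4]+[4k+3] ⟨
    n                             ∎))
    where
    open ≤-Reasoning
    c≤4k+3 : c ≤ 4 * k + 3
    c≤4k+3 = s≤s⁻¹ (subst (suc c ≤_) (+-suc (4 * k) 3) c<4k+4)
  ... | inj₂ refl = trans (offsetDist-middle {4} (s≤s (s≤s (s≤s (s≤s z≤n))))) (sym (⌈4a+m/4⌉≡a+⌈m/4⌉ k 4))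

  offsetDist-falling : ∀ {m} → m ≤ 4 * k + 4 → offsetDist (n ∸ m) ≡ ⌈ m /4⌉
  offsetDist-falling m≤4k+4 =
    trans (cong ⌈_/4⌉ (cyclicNorm-reflect (≤-trans m≤4k+4 4k+4≤n))) (offsetDist-rising m≤4k+4)

  position : Kind → ℕ → ℕ
  position (rising r)  b = 6 + (toℕ r + 4 * b)
  position (falling r) b = n ∸ suc (toℕ r + 4 * b)
  position (peak p)    _ = 4 * k + (5 + toℕ p)

  record Window (u : ℕ) : Set where
    field
      kind  : Kind
      level : ℕ
      dists : ∀ j → offsetDist (u ∸ toℕ j) ≡ level + shape kind j
      at    : u ≡ position kind level

  j≤5 : ∀ (j : Fin 6) → toℕ j ≤ 5
  j≤5 j = s≤s⁻¹ (Fin.toℕ<n j)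

  r+4[t/4]≡t : ∀ t → toℕ (fromℕ< (m%n<n t 4)) + 4 * (t / 4) ≡ t
  r+4[t/4]≡t t = begin
    toℕ (fromℕ< (m%n<n t 4)) + 4 * (t / 4) ≡⟨ cong₂ _+_ (Fin.toℕ-fromℕ< _) (*-comm 4 (t / 4)) ⟩
    t % 4 + t / 4 * 4                      ≡⟨ m≡m%n+[m/n]*n t 4 ⟨
    t                                      ∎
    where open ≡-Reasoning

  window-rising : ∀ t → 6 + t ≤ 4 * k + 4 → Window (6 + t)
  window-rising t 6+t≤4k+4 = record
    { kind = rising r ; level = t / 4 ; dists = dists ; at = cong (6 +_) (sym (r+4[t/4]≡t t)) }
    where
    r = fromℕ< (m%n<n t 4)
    rearrange : ∀ d r b → d + (r + 4 * b) ≡ 4 * b + (r + d)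
    rearrange = solve-∀
    dists : ∀ j → offsetDist (6 + t ∸ toℕ j) ≡ t / 4 + shape (rising r) j
    dists j = begin
      offsetDist (6 + t ∸ toℕ j)                      ≡⟨ offsetDist-rising (≤-trans (m∸n≤m (6 + t) (toℕ j)) 6+t≤4k+4) ⟩
      ⌈ 6 + t ∸ toℕ j /4⌉                             ≡⟨ cong ⌈_/4⌉ (+-∸-comm t (m≤n⇒m≤1+n (j≤5 j))) ⟩
      ⌈ 6 ∸ toℕ j + t /4⌉                             ≡⟨ cong (λ x → ⌈ 6 ∸ toℕ j + x /4⌉) (r+4[t/4]≡t t) ⟨
      ⌈ 6 ∸ toℕ j + (toℕ r + 4 * (t / 4)) /4⌉         ≡⟨ cong ⌈_/4⌉ (rearrange (6 ∸ toℕ j) (toℕ r) (t / 4)) ⟩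
      ⌈ 4 * (t / 4) + (toℕ r + (6 ∸ toℕ j)) /4⌉       ≡⟨ ⌈4a+m/4⌉≡a+⌈m/4⌉ (t / 4) _ ⟩
      t / 4 + shape (rising r) j                      ∎
      where open ≡-Reasoning

  window-falling : ∀ t → t + 2 ≤ 4 * k → Window (n ∸ suc t)
  window-falling t t+2≤4k = record
    { kind = falling r ; level = t / 4 ; dists = dists ; at = cong (λ x → n ∸ suc x) (sym (r+4[t/4]≡t t)) }
    where
    r = fromℕ< (m%n<n t 4)
    rearrange : ∀ j r b → suc (r + 4 * b) + j ≡ 4 * b + (suc r + j)
    rearrange = solve-∀
    t+6≡t+2+4 : ∀ t → suc t + 5 ≡ t + 2 + 4
    t+6≡t+2+4 = solve-∀
    dists : ∀ j → offsetDist (n ∸ suc t ∸ toℕ j) ≡ t / 4 + shape (falling r) j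
    dists j = begin
      offsetDist (n ∸ suc t ∸ toℕ j)                  ≡⟨ cong offsetDist (∸-+-assoc n (suc t) (toℕ j)) ⟩
      offsetDist (n ∸ (suc t + toℕ j))                ≡⟨ offsetDist-falling suc-t+j≤4k+4 ⟩
      ⌈ suc t + toℕ j /4⌉                             ≡⟨ cong (λ x → ⌈ suc x + toℕ j /4⌉) (r+4[t/4]≡t t) ⟨
      ⌈ suc (toℕ r + 4 * (t / 4)) + toℕ j /4⌉         ≡⟨ cong ⌈_/4⌉ (rearrange (toℕ j) (toℕ r) (t / 4)) ⟩
      ⌈ 4 * (t / 4) + (suc (toℕ r) + toℕ j) /4⌉       ≡⟨ ⌈4a+m/4⌉≡a+⌈m/4⌉ (t / 4) _ ⟩
      t / 4 + shape (falling r) j                     ∎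
      where
      open ≡-Reasoning
      suc-t+j≤4k+4 : suc t + toℕ j ≤ 4 * k + 4
      suc-t+j≤4k+4 = ≤-trans (+-monoʳ-≤ (suc t) (j≤5 j))
        (≤-trans (≤-reflexive (t+6≡t+2+4 t)) (+-monoˡ-≤ 4 t+2≤4k))

  window-peak : ∀ p → Window (4 * k + (5 + toℕ p))
  window-peak p = record { kind = peak p ; level = k ; dists = dists ; at = refl }
    where
    dists : ∀ j → offsetDist (4 * k + (5 + toℕ p) ∸ toℕ j) ≡ k + shape (peak p) j
    dists j = trans (cong offsetDist (+-∸-assoc (4 * k) j≤5+p)) (offsetDist-middle m≤7)
      where
      j≤5+p : toℕ j ≤ 5 + toℕ p
      j≤5+p = ≤-trans (j≤5 j) (m≤m+n 5 (toℕ p))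
      m≤7 : 5 + toℕ p ∸ toℕ j ≤ 7
      m≤7 = ≤-trans (m∸n≤m (5 + toℕ p) (toℕ j)) (+-monoʳ-≤ 5 (s≤s⁻¹ (Fin.toℕ<n p)))

  window : ∀ {u} → 6 ≤ u → u < n → Window u
  window {u} 6≤u u<n with u ≤? 4 * k + 4 | 4 * k + 8 ≤? u
  ... | yes u≤4k+4 | _ = subst Window 6+t≡u
    (window-rising t (subst (_≤ 4 * k + 4) (sym 6+t≡u) u≤4k+4))
    where
    t = proj₁ (m≤n⇒∃[o]m+o≡n 6≤u)
    6+t≡u = proj₂ (m≤n⇒∃[o]m+o≡n 6≤u)
  ... | no _ | yes 4k+8≤u = subst Window n∸suc-t≡u (window-falling t t+2≤4k)
    where
    t = proj₁ (m≤n⇒∃[o]m+o≡n u<n)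
    suc-u+t≡n = proj₂ (m≤n⇒∃[o]m+o≡n u<n)
    n∸suc-t≡u : n ∸ suc t ≡ u
    n∸suc-t≡u = trans (cong (_∸ suc t) (trans (sym suc-u+t≡n) (sym (+-suc u t)))) (m+n∸n≡m u (suc t))
    rearrange : ∀ t u → t + 2 + u ≡ suc u + t + 1
    rearrange = solve-∀
    n+1≡4k+[4k+8] : ∀ k → 8 * k + 7 + 1 ≡ 4 * k + (4 * k + 8)
    n+1≡4k+[4k+8] = solve-∀
    t+2≤4k : t + 2 ≤ 4 * k
    t+2≤4k = +-cancelʳ-≤ (4 * k + 8) (t + 2) (4 * k) (begin
      t + 2 + (4 * k + 8)   ≤⟨ +-monoʳ-≤ (t + 2) 4k+8≤u ⟩
      t + 2 + u             ≡⟨ rearrange t u ⟩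
      suc u + t + 1         ≡⟨ cong (_+ 1) suc-u+t≡n ⟩
      n + 1                 ≡⟨ n+1≡4k+[4k+8] k ⟩
      4 * k + (4 * k + 8)   ∎)
      where open ≤-Reasoning
  ... | no u≰4k+4 | no 4k+8≰u = subst Window 4k+[5+p]≡u (window-peak p)
    where
    4k+5≤u : 4 * k + 5 ≤ u
    4k+5≤u = subst (_≤ u) (sym (+-suc (4 * k) 4)) (≰⇒> u≰4k+4)
    e = proj₁ (m≤n⇒∃[o]m+o≡n 4k+5≤u)
    4k+5+e≡u = proj₂ (m≤n⇒∃[o]m+o≡n 4k+5≤u)
    e<3 : e < 3
    e<3 = +-cancelˡ-< (4 * k + 5) e 3 (begin-strict
      4 * k + 5 + e         ≡⟨ 4k+5+e≡u ⟩
      u                     <⟨ ≰⇒> 4k+8≰u ⟩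
      4 * k + 8             ≡⟨ +-assoc (4 * k) 5 3 ⟨
      4 * k + 5 + 3         ∎)
      where open ≤-Reasoning
    p = fromℕ< e<3
    4k+[5+p]≡u : 4 * k + (5 + toℕ p) ≡ u
    4k+[5+p]≡u = trans (cong (λ x → 4 * k + (5 + x)) (Fin.toℕ-fromℕ< e<3))
      (trans (sym (+-assoc (4 * k) 5 e)) 4k+5+e≡u)

  window-injective : ∀ {u v} → Window u → Window v →
                     (∀ j → offsetDist (u ∸ toℕ j) ≡ offsetDist (v ∸ toℕ j)) → u ≡ v
  window-injective {u} {v} wu wv same = begin
    u             ≡⟨ Window.at wu ⟩
    position κ x  ≡⟨ cong₂ position κ≡κ′ x≡y ⟩
    position κ′ y ≡⟨ Window.at wv ⟨
    v             ∎
    where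
    open ≡-Reasoning
    open Window wu renaming (kind to κ; level to x)
    open Window wv renaming (kind to κ′; level to y)
    levels : ∀ j → x + shape κ j ≡ y + shape κ′ j
    levels j = trans (sym (Window.dists wu j)) (trans (same j) (Window.dists wv j))
    κ≡κ′ : κ ≡ κ′
    κ≡κ′ = sameShape⇒≡ κ κ′ (λ j → x+a≡y+b∧x+c≡y+d⇒a+d≡b+c {x} {y} (levels j) (levels Fin.zero))
    x≡y : x ≡ y
    x≡y = +-cancelʳ-≡ (shape κ Fin.zero) x y
      (trans (levels Fin.zero) (cong (λ κ″ → y + shape κ″ Fin.zero) (sym κ≡κ′)))

  6≤n : 6 ≤ n
  6≤n = ≤-trans (n≤1+n 6) 7≤n

  landmark : Fin 6 → Fin n
  landmark j = inject≤ j 6≤n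

  landmarks : List (Fin n)
  landmarks = tabulate landmark

  ≤5⇒∈landmarks : ∀ {u} → toℕ u ≤ 5 → u ∈ landmarks
  ≤5⇒∈landmarks {u} u≤5 =
    subst (_∈ landmarks) landmark-u≡u (∈-tabulate⁺ {f = landmark} (fromℕ< (s≤s u≤5)))
    where
    landmark-u≡u : landmark (fromℕ< (s≤s u≤5)) ≡ u
    landmark-u≡u = Fin.toℕ-injective (trans (Fin.toℕ-inject≤ _ 6≤n) (Fin.toℕ-fromℕ< (s≤s u≤5)))

  offsetDist-from-landmark : ∀ j {u} → 6 ≤ toℕ u →
                             offsetDist (u ⊖ landmark j) ≡ offsetDist (toℕ u ∸ toℕ j)
  offsetDist-from-landmark j {u} 6≤u =
    cong offsetDist (trans (⊖-of-≤ landmark≤u) (cong (toℕ u ∸_) (Fin.toℕ-inject≤ j 6≤n)))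
    where
    landmark≤u : toℕ (landmark j) ≤ toℕ u
    landmark≤u = subst (_≤ toℕ u) (sym (Fin.toℕ-inject≤ j 6≤n)) (≤-trans (m≤n⇒m≤1+n (j≤5 j)) 6≤u)

  landmarkDist : Fin 6 → Fin n → ℕ
  landmarkDist j w = offsetDist (w ⊖ landmark j)

  Resolved : Fin n → Fin n → Set
  Resolved u v = ∃[ x ] (x ∈ landmarks × Distinguishes (Circ1234 n) x u v)

  resolve-far : ∀ {u v} → u ≢ v → 6 ≤ toℕ u → 6 ≤ toℕ v →
                Dec (∃[ j ] landmarkDist j u ≢ landmarkDist j v) → Resolved u v
  resolve-far _ _ _ (yes (j , differ)) =
    landmark j , ∈-tabulate⁺ {f = landmark} j , _ , _ , isDist-offsetDist _ _ , isDist-offsetDist _ _ , differ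
  resolve-far {u} {v} u≢v 6≤u 6≤v (no none) = ⊥-elim (u≢v (Fin.toℕ-injective
    (window-injective (window 6≤u (Fin.toℕ<n u)) (window 6≤v (Fin.toℕ<n v)) same)))
    where
    same : ∀ j → offsetDist (toℕ u ∸ toℕ j) ≡ offsetDist (toℕ v ∸ toℕ j)
    same j = begin
      offsetDist (toℕ u ∸ toℕ j)   ≡⟨ offsetDist-from-landmark j 6≤u ⟨
      landmarkDist j u             ≡⟨ decidable-stable (_ ≟ _) (λ differ → none (j , differ)) ⟩
      landmarkDist j v             ≡⟨ offsetDist-from-landmark j 6≤v ⟩
      offsetDist (toℕ v ∸ toℕ j)   ∎
      where open ≡-Reasoning

  -- The decisions are arguments because `with`-abstracting them out of the Resolving
  -- goal is prohibitively slow to type check.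
  resolve : ∀ {u v} → u ≢ v → Dec (toℕ u ≤ 5) → Dec (toℕ v ≤ 5) → Resolved u v
  resolve {u} {v} u≢v (yes u≤5) _ =
    u , ≤5⇒∈landmarks u≤5 , distinguishes-self u≢v (isDist-offsetDist u v)
  resolve {u} {v} u≢v (no _) (yes v≤5) =
    v , ≤5⇒∈landmarks v≤5 , distinguishes-sym (distinguishes-self (≢-sym u≢v) (isDist-offsetDist v u))
  resolve {u} {v} u≢v (no u≰5) (no v≰5) = resolve-far u≢v (≰⇒> u≰5) (≰⇒> v≰5)
    (Fin.any? λ j → ¬? (landmarkDist j u ≟ landmarkDist j v))

  resolving : Resolving (Circ1234 n) landmarks
  resolving u v u≢v = resolve u≢v (toℕ u ≤? 5) (toℕ v ≤? 5)

lemma5p2 : (k : ℕ) → 1 ≤ k → MetricDimLE (Circ1234 (8 * k + 7)) 6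
lemma5p2 k _ = landmarks , ≤-refl , resolving
  where open Order8k+7 k
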